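{- Let $k\le n$ be positive integers, let $I_{2k,2n}$ be the set of injections $[2k]\to[2n]$ and $I_{k,n}$ the set of injections $[k]\to[n]$, and let \[ S=\{f\in I_{2k,2n}\mid \exists g\in I_{k,n}\ \forall i\in[k]:\ f(2i-1)=g(i),\ f(2i)=n+g(i)\}. \] Let $y_{i,j}$ ($1\le i\le 2k$, $1\le j\le 2n$) be noncommuting variables and for $f\in I_{2k,2n}$ let $m_f=y_{1,f(1)}y_{2,f(2)}\cdots y_{2k,f(2k)}$. There is an ABP of size $\mathrm{poly}(n,k)$ computing a polynomial $F\in\mathbb{F}\langle y_{i,j}\rangle$ such that for each $f\in I_{2k,2n}$, the coefficient $[m_f]F$ equals $1$ if $f\in S$ and $0$ otherwise.
   Context: An ABP is a layered directed acyclic graph with one source and one sink, edges only between consecutive layers, each labelled by a linear form; it computes the sum over source-to-sink paths of the ordered product of the edge labels. -}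

module Defs where

open import Level using (Level; _⊔_)
open import Algebra.Bundles using (CommutativeRing)
open import Data.Nat as ℕ using (ℕ; zero; suc)
open import Data.Fin using (Fin; zero; suc; toℕ)
open import Data.List using (List; []; _∷_; map)
open import Data.List using () renaming (tabulate to tabulateL)
open import Data.Product using (Σ; ∃; _×_; _,_)
open import Function.Definitions using (Injective)
open import Relation.Binary.PropositionalEquality using (_≡_)
open import Relation.Nullary using (¬_)

record Field (c ℓ : Level) : Set (Level.suc (c ⊔ ℓ)) where
  field
    commRing : CommutativeRing c ℓ
  open CommutativeRing commRing public
  field
    0≉1     : ¬ (0# ≈ 1#)
    inverse : ∀ x → ¬ (x ≈ 0#) → Σ Carrier λ y → (x * y) ≈ 1#

module _ {c ℓ : Level} (R : CommutativeRing c ℓ) where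
  open CommutativeRing R using (Carrier; 0#; 1#; _+_; _*_)

  sumFin : (n : ℕ) → (Fin n → Carrier) → Carrier
  sumFin zero    h = 0#
  sumFin (suc n) h = h zero + sumFin n (λ i → h (suc i))

  -- Algebraic branching programs over variables X.
  -- 'Prog X a d' is the part of an ABP from a layer with 'a' vertices down to
  -- the sink, having 'd' further edge layers.  Edges between consecutive layers
  -- are given by labels 'L u v : X → Carrier', the coefficient vector of the
  -- (homogeneous) linear form labelling edge u → v (label 0 = no edge).
  data Prog (X : Set) : ℕ → ℕ → Set c where
    sink  : Prog X 1 0
    layer : ∀ {a d} (b : ℕ) → (Fin a → Fin b → X → Carrier) → Prog X b d →
            Prog X a (suc d)

  size : ∀ {X a d} → Prog X a d → ℕ
  size {a = a} sink          = a
  size {a = a} (layer b L p) = a ℕ.+ size p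

  -- evalW p w u = coefficient of the word w (a noncommutative monomial) in the
  -- polynomial computed between vertex u of the current layer and the sink:
  -- the sum over paths of the ordered product of the edge labels.
  evalW : ∀ {X a d} → Prog X a d → List X → Fin a → Carrier
  evalW sink          []      u = 1#
  evalW sink          (_ ∷ _) u = 0#
  evalW (layer b L p) []      u = 0#
  evalW (layer b L p) (x ∷ w) u = sumFin b (λ v → L u v x * evalW p w v)

  ABP : Set → Set c
  ABP X = Σ ℕ λ d → Prog X 1 d

  abpSize : ∀ {X} → ABP X → ℕ
  abpSize (d , p) = size p

  coeff : ∀ {X} → ABP X → List X → Carrier
  coeff (d , p) w = evalW p w zero

-- Variables y_{i,j}, 1 ≤ i ≤ 2k, 1 ≤ j ≤ 2n (0-indexed here)
Var : ℕ → ℕ → Set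
Var k n = Fin (2 ℕ.* k) × Fin (2 ℕ.* n)

monomial : ∀ k n → (Fin (2 ℕ.* k) → Fin (2 ℕ.* n)) → List (Var k n)
monomial k n f = tabulateL (λ i → (i , f i))

-- membership in S (0-indexed: positions 2i-1, 2i become 2i, 2i+1;
-- n + g(i) stays n + g(i))
InS : (k n : ℕ) → (Fin (2 ℕ.* k) → Fin (2 ℕ.* n)) → Set
InS k n f = ∃ λ (g : Fin k → Fin n) → Injective _≡_ _≡_ g ×
  (∀ (i : Fin k) (j : Fin (2 ℕ.* k)) →
     (toℕ j ≡ 2 ℕ.* toℕ i → toℕ (f j) ≡ toℕ (g i)) ×
     (toℕ j ≡ suc (2 ℕ.* toℕ i) → toℕ (f j) ≡ n ℕ.+ toℕ (g i)))

-- The ABP has k identical blocks, each fanning out from a hub to n vertices and back: the edge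
-- into vertex v is labelled Σᵢ y_{i,v} and the edge out of it Σᵢ y_{i,n+v}.  So it computes
-- (Σ_{v<n} (Σᵢ y_{i,v})(Σᵢ y_{i,n+v}))^k, and the coefficient of a word is 1 exactly when its
-- column sequence is a₁, n+a₁, …, a_k, n+a_k with every aᵢ < n, and 0 otherwise.  For an
-- injective f this says f ∈ S with g(i) = aᵢ; g is injective because f is.  The ABP has
-- 1 + k(n+1) vertices.
module Submission where

open import Algebra.Bundles using (CommutativeRing)
open import Data.Bool using (Bool; true; false; _∧_; T; if_then_else_)
open import Data.Bool.Properties using (T-∧)
open import Data.Empty using (⊥-elim)
open import Data.Fin using (Fin; zero; suc; toℕ; fromℕ<)
open import Data.Fin.Properties using (toℕ-fromℕ<; toℕ<n; toℕ-injective)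
open import Data.List using (List; []; _∷_; map; applyUpTo) renaming (tabulate to tabulateL)
open import Data.List.Properties using (map-tabulate)
open import Data.Nat using (ℕ; zero; suc; _+_; _*_; _^_; _≤_; _<_; _<ᵇ_; _≡ᵇ_)
open import Data.Nat.Properties as ℕₚ
  using (<ᵇ⇒<; <⇒<ᵇ; ≡ᵇ⇒≡; ≡⇒≡ᵇ; *-suc; +-suc; *-comm; *-cancelˡ-≡; *-mono-≤; *-monoʳ-≤; *-monoʳ-<;
         +-mono-≤; +-monoʳ-≤; +-comm; m≤n+m; ≤-trans; module ≤-Reasoning)
open import Data.Product using (Σ; _×_; _,_; proj₁; proj₂)
open import Function using (_∘_; _⇔_; mk⇔; Equivalence)
open import Function.Construct.Composition using (_⇔-∘_)
open import Function.Construct.Symmetry using (⇔-sym)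
open import Function.Definitions using (Injective)
open import Relation.Binary.PropositionalEquality
  using (_≡_; refl; sym; trans; cong; cong₂; subst; module ≡-Reasoning)
import Relation.Binary.Reasoning.Setoid as SetoidReasoning
open import Relation.Nullary using (¬_)

open import Defs

pairedᵇ : ℕ → ℕ → List ℕ → Bool
pairedᵇ n zero    []          = true
pairedᵇ n (suc m) (a ∷ b ∷ w) = ((a <ᵇ n) ∧ (b ≡ᵇ n + a)) ∧ pairedᵇ n m w
pairedᵇ n _       _           = false

PairFrom : ℕ → (ℕ → ℕ) → ℕ → Set
PairFrom n ψ p = ψ p < n × ψ (suc p) ≡ n + ψ p

PairAt : ℕ → (ℕ → ℕ) → ℕ → Set
PairAt n ψ i = PairFrom n ψ (2 * i)

PairAt-suc : ∀ n ψ i → PairAt n (ψ ∘ (2 +_)) i ⇔ PairAt n ψ (suc i)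
PairAt-suc n ψ i = mk⇔ (subst (PairFrom n ψ) (sym (*-suc 2 i))) (subst (PairFrom n ψ) (*-suc 2 i))

pairedᵇ-applyUpTo : ∀ n k ψ →
  T (pairedᵇ n k (applyUpTo ψ (k * 2))) ⇔ (∀ (i : Fin k) → PairAt n ψ (toℕ i))
pairedᵇ-applyUpTo n zero    ψ = mk⇔ (λ _ ()) _
pairedᵇ-applyUpTo n (suc k) ψ = mk⇔ split join
  where
    open Equivalence
    Paired : Set
    Paired = T (pairedᵇ n (suc k) (applyUpTo ψ (suc k * 2)))
    tail : T (pairedᵇ n k (applyUpTo (ψ ∘ (2 +_)) (k * 2))) ⇔ (∀ i → PairAt n (ψ ∘ (2 +_)) (toℕ i))
    tail = pairedᵇ-applyUpTo n k (ψ ∘ (2 +_))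
    head : T ((ψ 0 <ᵇ n) ∧ (ψ 1 ≡ᵇ n + ψ 0)) ⇔ PairAt n ψ 0
    head = mk⇔ (λ t → let a , b = T-∧ .to t in <ᵇ⇒< _ _ a , ≡ᵇ⇒≡ _ _ b)
               (λ (a , b) → T-∧ .from (<⇒<ᵇ a , ≡⇒≡ᵇ _ _ b))
    split : Paired → ∀ i → PairAt n ψ (toℕ i)
    split t zero    = head .to (proj₁ (T-∧ .to t))
    split t (suc i) = PairAt-suc n ψ (toℕ i) .to (tail .to (proj₂ (T-∧ .to t)) i)
    join : (∀ i → PairAt n ψ (toℕ i)) → Paired
    join h = T-∧ .from (head .from (h zero) , tail .from λ i → PairAt-suc n ψ (toℕ i) .from (h (suc i)))

module _ {c ℓ} (R : CommutativeRing c ℓ) where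
  open CommutativeRing R
    using (Carrier; _≈_; 0#; 1#; setoid; +-cong; +-congˡ; *-cong; *-congˡ; *-assoc;
           +-identityˡ; +-identityʳ; *-identityˡ; zeroˡ; zeroʳ)
    renaming (_+_ to _⊕_; _*_ to _⊛_; refl to ≈-refl; sym to ≈-sym; trans to ≈-trans)
  open SetoidReasoning setoid

  𝟙 : Bool → Carrier
  𝟙 b = if b then 1# else 0#

  𝟙-∧ : ∀ a b → 𝟙 a ⊛ 𝟙 b ≈ 𝟙 (a ∧ b)
  𝟙-∧ true  b = *-identityˡ (𝟙 b)
  𝟙-∧ false b = zeroˡ (𝟙 b)

  𝟙-indicates : ∀ {P : Set} {b x} → P ⇔ T b → x ≈ 𝟙 b → (P → x ≈ 1#) × (¬ P → x ≈ 0#)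
  𝟙-indicates {b = true}  P⇔b x≈1 = (λ _ → x≈1) , (λ ¬p → ⊥-elim (¬p (Equivalence.from P⇔b _)))
  𝟙-indicates {b = false} P⇔b x≈0 = (λ p → ⊥-elim (Equivalence.to P⇔b p)) , (λ _ → x≈0)

  sumFin-cong : ∀ m {h h′ : Fin m → Carrier} → (∀ v → h v ≈ h′ v) → sumFin R m h ≈ sumFin R m h′
  sumFin-cong zero    h≈h′ = ≈-refl
  sumFin-cong (suc m) h≈h′ = +-cong (h≈h′ zero) (sumFin-cong m (h≈h′ ∘ suc))

  sumFin-zero : ∀ m {h : Fin m → Carrier} → (∀ v → h v ≈ 0#) → sumFin R m h ≈ 0#
  sumFin-zero zero    h≈0 = ≈-refl
  sumFin-zero (suc m) h≈0 = ≈-trans (+-cong (h≈0 zero) (sumFin-zero m (h≈0 ∘ suc))) (+-identityʳ 0#)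

  sumFin-select : ∀ m t (h : ℕ → Carrier) →
    sumFin R m (λ v → 𝟙 (t ≡ᵇ toℕ v) ⊛ h (toℕ v)) ≈ 𝟙 (t <ᵇ m) ⊛ h t
  sumFin-select zero    t       h = ≈-sym (zeroˡ (h t))
  sumFin-select (suc m) zero    h = begin
    1# ⊛ h 0 ⊕ sumFin R m (λ v → 0# ⊛ h (suc (toℕ v)))
      ≈⟨ +-congˡ (sumFin-zero m λ v → zeroˡ _) ⟩
    1# ⊛ h 0 ⊕ 0#
      ≈⟨ +-identityʳ _ ⟩
    1# ⊛ h 0
      ∎
  sumFin-select (suc m) (suc t) h = begin
    0# ⊛ h 0 ⊕ sumFin R m (λ v → 𝟙 (t ≡ᵇ toℕ v) ⊛ h (suc (toℕ v)))
      ≈⟨ +-cong (zeroˡ _) (sumFin-select m t (h ∘ suc)) ⟩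
    0# ⊕ 𝟙 (t <ᵇ m) ⊛ h (suc t)
      ≈⟨ +-identityˡ _ ⟩
    𝟙 (t <ᵇ m) ⊛ h (suc t)
      ∎

  module _ {X : Set} (col : X → ℕ) (n : ℕ) where

    -- Depth m * 2 rather than 2 * m, so that suc m * 2 reduces to suc (suc (m * 2)).
    pairing : (m : ℕ) → Prog R X 1 (m * 2)
    pairing zero    = sink
    pairing (suc m) =
      layer n (λ _ v x → 𝟙 (col x ≡ᵇ toℕ v)) (layer 1 (λ v _ y → 𝟙 (col y ≡ᵇ n + toℕ v)) (pairing m))

    size-pairing : ∀ m → size R (pairing m) ≡ 1 + m * (1 + n)
    size-pairing zero    = refl
    size-pairing (suc m) = cong suc (trans (cong (n +_) (size-pairing m)) (+-suc n _))

    evalW-pairing : ∀ m w → evalW R (pairing m) w zero ≈ 𝟙 (pairedᵇ n m (map col w))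
    evalW-pairing zero    []          = ≈-refl
    evalW-pairing zero    (x ∷ w)     = ≈-refl
    evalW-pairing (suc m) []          = ≈-refl
    evalW-pairing (suc m) (x ∷ [])    = sumFin-zero n λ v → zeroʳ _
    evalW-pairing (suc m) (x ∷ y ∷ w) = begin
      sumFin R n (λ v → 𝟙 (col x ≡ᵇ toℕ v) ⊛ (𝟙 (col y ≡ᵇ n + toℕ v) ⊛ E ⊕ 0#))
        ≈⟨ sumFin-cong n (λ v → *-congˡ (+-identityʳ _)) ⟩
      sumFin R n (λ v → 𝟙 (col x ≡ᵇ toℕ v) ⊛ (𝟙 (col y ≡ᵇ n + toℕ v) ⊛ E))
        ≈⟨ sumFin-select n (col x) (λ j → 𝟙 (col y ≡ᵇ n + j) ⊛ E) ⟩
      𝟙 (col x <ᵇ n) ⊛ (𝟙 (col y ≡ᵇ n + col x) ⊛ E)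
        ≈⟨ ≈-sym (*-assoc _ _ _) ⟩
      𝟙 (col x <ᵇ n) ⊛ 𝟙 (col y ≡ᵇ n + col x) ⊛ E
        ≈⟨ *-cong (𝟙-∧ _ _) (evalW-pairing m w) ⟩
      𝟙 ((col x <ᵇ n) ∧ (col y ≡ᵇ n + col x)) ⊛ 𝟙 (pairedᵇ n m (map col w))
        ≈⟨ 𝟙-∧ _ _ ⟩
      𝟙 (pairedᵇ n (suc m) (map col (x ∷ y ∷ w)))
        ∎
      where
        E : Carrier
        E = evalW R (pairing m) w zero

extendℕ : ∀ {L} → (Fin L → ℕ) → ℕ → ℕ
extendℕ {zero}  φ j       = 0
extendℕ {suc L} φ zero    = φ zero
extendℕ {suc L} φ (suc j) = extendℕ (φ ∘ suc) j

extendℕ-toℕ : ∀ {L} (φ : Fin L → ℕ) i → extendℕ φ (toℕ i) ≡ φ i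
extendℕ-toℕ φ zero    = refl
extendℕ-toℕ φ (suc i) = extendℕ-toℕ (φ ∘ suc) i

tabulate-applyUpTo : ∀ {A : Set} {L} {φ : Fin L → A} {ψ : ℕ → A} →
  (∀ i → ψ (toℕ i) ≡ φ i) → tabulateL φ ≡ applyUpTo ψ L
tabulate-applyUpTo {L = zero}  ψ≡φ = refl
tabulate-applyUpTo {L = suc L} ψ≡φ = cong₂ _∷_ (sym (ψ≡φ zero)) (tabulate-applyUpTo (ψ≡φ ∘ suc))

module _ {k : ℕ} where

  even : Fin k → Fin (2 * k)
  even i = fromℕ< (*-monoʳ-< 2 (toℕ<n i))

  odd : Fin k → Fin (2 * k)
  odd i = fromℕ< (subst (_≤ 2 * k) (*-suc 2 (toℕ i)) (*-monoʳ-≤ 2 (toℕ<n i)))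

  toℕ-even : ∀ i → toℕ (even i) ≡ 2 * toℕ i
  toℕ-even i = toℕ-fromℕ< _

  toℕ-odd : ∀ i → toℕ (odd i) ≡ suc (2 * toℕ i)
  toℕ-odd i = toℕ-fromℕ< _

  even-injective : Injective _≡_ _≡_ even
  even-injective {i} {i′} e =
    toℕ-injective (*-cancelˡ-≡ _ _ 2 (trans (sym (toℕ-even i)) (trans (cong toℕ e) (toℕ-even i′))))

module _ {k n} (f : Fin (2 * k) → Fin (2 * n)) (ψ : ℕ → ℕ) (ψ-toℕ : ∀ j → ψ (toℕ j) ≡ toℕ (f j)) where

  ψ-at : ∀ {p} j → toℕ j ≡ p → ψ p ≡ toℕ (f j)
  ψ-at j refl = ψ-toℕ j

  InS⇒PairAt : InS k n f → ∀ i → PairAt n ψ (toℕ i)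
  InS⇒PairAt (g , _ , H) i = subst (_< n) (sym ψ₀≡g) (toℕ<n (g i)) , ψ₁≡n+ψ₀
    where
      ψ₀≡g : ψ (2 * toℕ i) ≡ toℕ (g i)
      ψ₀≡g = trans (ψ-at (even i) (toℕ-even i)) (proj₁ (H i (even i)) (toℕ-even i))
      ψ₁≡n+ψ₀ : ψ (suc (2 * toℕ i)) ≡ n + ψ (2 * toℕ i)
      ψ₁≡n+ψ₀ = trans (ψ-at (odd i) (toℕ-odd i))
                  (trans (proj₂ (H i (odd i)) (toℕ-odd i)) (cong (n +_) (sym ψ₀≡g)))

  PairAt⇒InS : Injective _≡_ _≡_ f → (∀ i → PairAt n ψ (toℕ i)) → InS k n f
  PairAt⇒InS f-inj pairs = g , g-injective , λ i j → f-at-even i j , f-at-odd i j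
    where
      g : Fin k → Fin n
      g i = fromℕ< (proj₁ (pairs i))
      toℕ-g : ∀ i → toℕ (g i) ≡ ψ (2 * toℕ i)
      toℕ-g i = toℕ-fromℕ< _
      f-at-even : ∀ i j → toℕ j ≡ 2 * toℕ i → toℕ (f j) ≡ toℕ (g i)
      f-at-even i j e = trans (sym (ψ-at j e)) (sym (toℕ-g i))
      f-at-odd : ∀ i j → toℕ j ≡ suc (2 * toℕ i) → toℕ (f j) ≡ n + toℕ (g i)
      f-at-odd i j e = trans (sym (ψ-at j e)) (trans (proj₂ (pairs i)) (cong (n +_) (sym (toℕ-g i))))
      f-even : ∀ i → toℕ (f (even i)) ≡ toℕ (g i)
      f-even i = f-at-even i (even i) (toℕ-even i)
      g-injective : Injective _≡_ _≡_ g
      g-injective {i} {i′} e =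
        even-injective (f-inj (toℕ-injective (trans (f-even i) (trans (cong toℕ e) (sym (f-even i′))))))

column : ∀ {a b} → Fin a × Fin b → ℕ
column = toℕ ∘ proj₂

columns-monomial : ∀ k n (f : Fin (2 * k) → Fin (2 * n)) →
  map column (monomial k n f) ≡ applyUpTo (extendℕ (toℕ ∘ f)) (k * 2)
columns-monomial k n f = begin
  map column (tabulateL (λ i → i , f i))  ≡⟨ map-tabulate _ column ⟩
  tabulateL (toℕ ∘ f)                     ≡⟨ tabulate-applyUpTo (extendℕ-toℕ (toℕ ∘ f)) ⟩
  applyUpTo (extendℕ (toℕ ∘ f)) (2 * k)   ≡⟨ cong (applyUpTo _) (*-comm 2 k) ⟩
  applyUpTo (extendℕ (toℕ ∘ f)) (k * 2)   ∎
  where open ≡-Reasoning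

InS⇔pairedᵇ : ∀ {k n} {f : Fin (2 * k) → Fin (2 * n)} → Injective _≡_ _≡_ f →
  InS k n f ⇔ T (pairedᵇ n k (map column (monomial k n f)))
InS⇔pairedᵇ {k} {n} {f} f-inj =
  subst (λ w → InS k n f ⇔ T (pairedᵇ n k w)) (sym (columns-monomial k n f))
    (⇔-sym (pairedᵇ-applyUpTo n k ψ) ⇔-∘ mk⇔ (InS⇒PairAt f ψ ψ-toℕ) (PairAt⇒InS f ψ ψ-toℕ f-inj))
  where
    ψ : ℕ → ℕ
    ψ = extendℕ (toℕ ∘ f)
    ψ-toℕ : ∀ j → ψ (toℕ j) ≡ toℕ (f j)
    ψ-toℕ = extendℕ-toℕ (toℕ ∘ f)

double-square : ∀ s → s * s + s * s ≡ 2 * s ^ 2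
double-square s = trans (cong (s * s +_) (sym (ℕₚ.+-identityʳ (s * s))))
  (cong₂ (λ a b → s * a + (s * b + 0)) (sym (ℕₚ.*-identityʳ s)) (sym (ℕₚ.*-identityʳ s)))

size-bound : ∀ k n → 1 ≤ k → 1 + k * (1 + n) ≤ 2 * (n + k) ^ 2
size-bound k n 1≤k = begin
  1 + k * (1 + n)        ≤⟨ +-mono-≤ (*-mono-≤ 1≤s 1≤s) (*-mono-≤ (m≤n+m k n) 1+n≤s) ⟩
  s * s + s * s          ≡⟨ double-square s ⟩
  2 * (n + k) ^ 2        ∎
  where
    open ≤-Reasoning
    s : ℕ
    s = n + k
    1≤s : 1 ≤ s
    1≤s = ≤-trans 1≤k (m≤n+m k n)
    1+n≤s : 1 + n ≤ s
    1+n≤s = subst (_≤ s) (+-comm n 1) (+-monoʳ-≤ n 1≤k)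

lemma6 : ∀ {c ℓ} (𝔽 : Field c ℓ) →
    Σ ℕ λ e → ∀ (k n : ℕ) → 1 ≤ k → k ≤ n →
      Σ (ABP (Field.commRing 𝔽) (Var k n)) λ A →
        (abpSize (Field.commRing 𝔽) A ≤ e * (n + k) ^ e) ×
        (∀ (f : Fin (2 * k) → Fin (2 * n)) → Injective _≡_ _≡_ f →
          (InS k n f → Field._≈_ 𝔽 (coeff (Field.commRing 𝔽) A (monomial k n f)) (Field.1# 𝔽)) ×
          (¬ InS k n f → Field._≈_ 𝔽 (coeff (Field.commRing 𝔽) A (monomial k n f)) (Field.0# 𝔽)))
lemma6 𝔽 = 2 , λ k n 1≤k _ →
  (k * 2 , pairing R column n k) ,
  subst (_≤ 2 * (n + k) ^ 2) (sym (size-pairing R column n k)) (size-bound k n 1≤k) ,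
  λ f f-inj → 𝟙-indicates R (InS⇔pairedᵇ f-inj) (evalW-pairing R column n k (monomial k n f))
  where
    R : CommutativeRing _ _
    R = Field.commRing 𝔽
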